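{- Let $n$, $d$, $q$ be positive integers with $q$ odd, and let $S_n(N) = 1^n + 2^n + \dots + N^n$ for a positive integer $N$. Then $$v_2\big(S_n(2^d q)\big) = \begin{cases} d-1 & \text{if } n=1 \text{ or } n \text{ is even},\\ 2(d-1) & \text{if } n\ge 3 \text{ is odd}.\end{cases}$$
   Context: For a prime $p$ and a nonzero integer $k$, $v_p(k)$ denotes the largest integer $v$ such that $p^v$ divides $k$. -}

module Defs where

open import Data.Nat using (ℕ; zero; suc; _+_; _*_; _^_; _<_; _≤_)
open import Data.Nat.Divisibility using (_∣_)
open import Relation.Nullary using (¬_)
open import Data.Product using (_×_)

S : ℕ → ℕ → ℕ
S n zero    = 0
S n (suc N) = S n N + suc N ^ n

IsVal : ℕ → ℕ → ℕ → Set
IsVal p k v = (p ^ v ∣ k) × ¬ (p ^ suc v ∣ k)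

-- Write N = 2^(e+1) q (so d = e + 1).  The proof rests on two congruences
-- modulo squares, both instances of the binomial estimate
--     (y + x)^(m+1) ≡ x^(m+1) + (m+1) y x^m   (mod y²)   (proved over ℤ):
--   * doubling:  S n (M + L) ≡ S n M + S n L + n M S (n-1) L   (mod M²);
--   * pairing:   2 S n N ≡ n N S (n-1) N   (mod N²)   for odd n ≥ 3,
--     obtained by summing k^n + (N-k)^n ≡ n N k^(n-1) over 0 ≤ k ≤ N.
-- A congruence modulo a multiple of 2^(v+1) preserves the property of having
-- 2-adic valuation v.  Hence:
--   * n even: S n (2q) is odd, and doubling N shows v(S n (2N)) = v(S n N) + 1,
--     so v(S n N) = e by induction on e;
--   * n = 1: 2 S 1 N = N (N + 1) has valuation e + 1;
--   * n odd ≥ 3: by pairing and the even case, v(2 S n N) = v(n N S (n-1) N)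
--     = (e + 1) + e, so v(S n N) = 2e.
module Submission where

open import Defs
open import Data.Nat using (ℕ; suc; _+_; _*_; _^_; _∸_; _≤_)
open import Data.Nat.Divisibility using (_∣_)
open import Data.Product using (_×_)
open import Data.Sum using (_⊎_)
open import Relation.Nullary using (¬_)
open import Relation.Binary.PropositionalEquality using (_≡_)

open import Data.Nat using (zero; z≤n; s≤s; NonZero)
open import Data.Nat.Properties
  using (+-comm; +-assoc; +-suc; +-identityʳ; *-comm; *-distribˡ-+; ≤-refl; m≤n⇒m≤1+n;
         +-∸-assoc; n∸n≡0; m+[n∸m]≡n; *-cancelˡ-≡; m^n≢0; ^-distribˡ-+-*; even≢odd)
open import Data.Nat.Divisibility
  using (divides; ∣-refl; ∣-trans; ∣m∣n⇒∣m+n; ∣m+n∣m⇒∣n; ∣m⇒∣m*n; *-monoʳ-∣; *-cancelˡ-∣)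
open import Data.Nat.Tactic.RingSolver using (solve-∀)
open import Data.Product using (Σ; _,_)
open import Data.Sum using (inj₁; inj₂)
open import Data.Empty using (⊥-elim)
import Data.Integer as ℤ
open ℤ using (ℤ; +_; -[1+_])
import Data.Integer.Properties as ℤₚ
open import Data.Integer.Tactic.RingSolver using () renaming (solve-∀ to solve-∀ℤ)
open import Relation.Binary.PropositionalEquality
  using (refl; sym; trans; cong; cong₂; subst; module ≡-Reasoning)

sumTo : (ℕ → ℕ) → ℕ → ℕ
sumTo f zero    = f 0
sumTo f (suc N) = sumTo f N + f (suc N)

-- For a positive exponent the k = 0 term vanishes, so sumTo recovers S.
sumTo-pow : ∀ m N → sumTo (_^ suc m) N ≡ S (suc m) N
sumTo-pow m zero    = refl
sumTo-pow m (suc N) = cong (_+ suc N ^ suc m) (sumTo-pow m N)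

sumTo-cong : ∀ f g N → (∀ k → k ≤ N → f k ≡ g k) → sumTo f N ≡ sumTo g N
sumTo-cong f g zero    f≗g = f≗g 0 z≤n
sumTo-cong f g (suc N) f≗g =
  cong₂ _+_ (sumTo-cong f g N (λ k k≤N → f≗g k (m≤n⇒m≤1+n k≤N))) (f≗g (suc N) ≤-refl)

sumTo-+ : ∀ f g N → sumTo (λ k → f k + g k) N ≡ sumTo f N + sumTo g N
sumTo-+ f g zero    = refl
sumTo-+ f g (suc N) =
  trans (cong (_+ (f (suc N) + g (suc N))) (sumTo-+ f g N))
        (interchange (sumTo f N) (sumTo g N) (f (suc N)) (g (suc N)))
  where
  interchange : ∀ a b c d → (a + b) + (c + d) ≡ (a + c) + (b + d)
  interchange = solve-∀

sumTo-*ˡ : ∀ c f N → sumTo (λ k → c * f k) N ≡ c * sumTo f N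
sumTo-*ˡ c f zero    = refl
sumTo-*ˡ c f (suc N) =
  trans (cong (_+ c * f (suc N)) (sumTo-*ˡ c f N)) (sym (*-distribˡ-+ c _ _))

sumTo-head : ∀ f N → sumTo f (suc N) ≡ f 0 + sumTo (λ k → f (suc k)) N
sumTo-head f zero    = refl
sumTo-head f (suc N) =
  trans (cong (_+ f (suc (suc N))) (sumTo-head f N)) (+-assoc (f 0) _ _)

sumTo-reverse : ∀ f N → sumTo (λ k → f (N ∸ k)) N ≡ sumTo f N
sumTo-reverse f zero    = refl
sumTo-reverse f (suc N) = begin
  sumTo (λ k → f (suc N ∸ k)) N + f (suc N ∸ suc N)
    ≡⟨ cong₂ _+_ (sumTo-cong _ _ N (λ k k≤N → cong f (+-∸-assoc 1 k≤N))) (cong f (n∸n≡0 N)) ⟩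
  sumTo (λ k → f (suc (N ∸ k))) N + f 0
    ≡⟨ cong (_+ f 0) (sumTo-reverse (λ k → f (suc k)) N) ⟩
  sumTo (λ k → f (suc k)) N + f 0
    ≡⟨ +-comm _ (f 0) ⟩
  f 0 + sumTo (λ k → f (suc k)) N
    ≡⟨ sym (sumTo-head f N) ⟩
  sumTo f (suc N) ∎
  where open ≡-Reasoning

parity : ∀ m → (Σ ℕ λ a → m ≡ 2 * a) ⊎ (Σ ℕ λ a → m ≡ 1 + 2 * a)
parity zero    = inj₁ (0 , refl)
parity (suc m) with parity m
... | inj₁ (a , m≡2a)   = inj₂ (a , cong suc m≡2a)
... | inj₂ (a , m≡1+2a) = inj₁ (suc a , trans (cong suc m≡1+2a) (next-even a))
  where
  next-even : ∀ a → 2 + 2 * a ≡ 2 * suc a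
  next-even = solve-∀

odd-^ : ∀ s m → Σ ℕ λ a → (1 + 2 * s) ^ m ≡ 1 + 2 * a
odd-^ s zero    = 0 , refl
odd-^ s (suc m) with odd-^ s m
... | a , eq = a + s + 2 * s * a , trans (cong ((1 + 2 * s) *_) eq) (expand s a)
  where
  expand : ∀ s a → (1 + 2 * s) * (1 + 2 * a) ≡ 1 + 2 * (a + s + 2 * s * a)
  expand = solve-∀

-- Among 1, ..., 2j exactly j terms k^n (n ≥ 1) are odd, so S n (2j) ≡ j mod 2.
S-parity : ∀ m j → Σ ℕ λ t → S (suc m) (2 * j) ≡ j + 2 * t
S-parity m zero    = 0 , refl
S-parity m (suc j) with S-parity m j | odd-^ j (suc m)
... | t , S≡ | a , odd≡ = t + a + (1 + j) * (2 + 2 * j) ^ m , (begin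
  S (suc m) (2 * suc j)
    ≡⟨ cong (S (suc m)) (double-suc j) ⟩
  S (suc m) (2 * j) + (1 + 2 * j) ^ suc m + (2 + 2 * j) ^ suc m
    ≡⟨ cong (λ z → z + (2 + 2 * j) ^ suc m) (cong₂ _+_ S≡ odd≡) ⟩
  j + 2 * t + (1 + 2 * a) + (2 + 2 * j) * (2 + 2 * j) ^ m
    ≡⟨ regroup j t a ((2 + 2 * j) ^ m) ⟩
  suc j + 2 * (t + a + (1 + j) * (2 + 2 * j) ^ m) ∎)
  where
  open ≡-Reasoning
  double-suc : ∀ j → 2 * suc j ≡ 2 + 2 * j
  double-suc = solve-∀
  regroup : ∀ j t a P →
    j + 2 * t + (1 + 2 * a) + (2 + 2 * j) * P ≡ suc j + 2 * (t + a + (1 + j) * P)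
  regroup = solve-∀

IsVal-*ˡ : ∀ {p x v} .{{_ : NonZero p}} → IsVal p x v → IsVal p (p * x) (suc v)
IsVal-*ˡ {p} (pᵛ∣x , pᵛ⁺¹∤x) = *-monoʳ-∣ p pᵛ∣x , λ pᵛ⁺²∣px → pᵛ⁺¹∤x (*-cancelˡ-∣ p pᵛ⁺²∣px)

IsVal-*ˡ⁻¹ : ∀ {p x v} .{{_ : NonZero p}} → IsVal p (p * x) (suc v) → IsVal p x v
IsVal-*ˡ⁻¹ {p} (pᵛ⁺¹∣px , pᵛ⁺²∤px) = *-cancelˡ-∣ p pᵛ⁺¹∣px , λ pᵛ⁺¹∣x → pᵛ⁺²∤px (*-monoʳ-∣ p pᵛ⁺¹∣x)

-- Odd-part presentation of valuation v: x = 2^v · (1 + 2s).  Unlike IsVal,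
-- this form is directly multiplicative.
record Val₂ (x v : ℕ) : Set where
  constructor odd-part
  field
    s  : ℕ
    x≡ : x ≡ 2 ^ v * (1 + 2 * s)

Val₂⇒IsVal : ∀ {x v} → Val₂ x v → IsVal 2 x v
Val₂⇒IsVal {x} {v} (odd-part s x≡) = divides (1 + 2 * s) (trans x≡ (*-comm (2 ^ v) _)) , 2ᵛ⁺¹∤x
  where
  2ᵛ⁺¹∤x : ¬ (2 ^ suc v ∣ x)
  2ᵛ⁺¹∤x (divides c x≡c2ᵛ⁺¹) =
    even≢odd c s (sym (*-cancelˡ-≡ (1 + 2 * s) (2 * c) (2 ^ v) {{m^n≢0 2 v}}
      (trans (sym x≡) (trans x≡c2ᵛ⁺¹ (reassoc c (2 ^ v))))))
    where
    reassoc : ∀ c P → c * (2 * P) ≡ P * (2 * c)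
    reassoc = solve-∀

IsVal⇒Val₂ : ∀ {x v} → IsVal 2 x v → Val₂ x v
IsVal⇒Val₂ {x} {v} (divides c x≡c2ᵛ , 2ᵛ⁺¹∤x) with parity c
... | inj₁ (a , c≡2a)   =
  ⊥-elim (2ᵛ⁺¹∤x (divides a (trans x≡c2ᵛ (trans (cong (_* 2 ^ v) c≡2a) (reassoc a (2 ^ v))))))
  where
  reassoc : ∀ a P → 2 * a * P ≡ a * (2 * P)
  reassoc = solve-∀
... | inj₂ (a , c≡1+2a) =
  odd-part a (trans x≡c2ᵛ (trans (cong (_* 2 ^ v) c≡1+2a) (*-comm _ (2 ^ v))))

Val₂-* : ∀ {x y a b} → Val₂ x a → Val₂ y b → Val₂ (x * y) (a + b)
Val₂-* {x} {y} {a} {b} (odd-part s x≡) (odd-part t y≡) = odd-part (s + t + 2 * s * t) (begin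
  x * y                                          ≡⟨ cong₂ _*_ x≡ y≡ ⟩
  2 ^ a * (1 + 2 * s) * (2 ^ b * (1 + 2 * t))    ≡⟨ regroup (2 ^ a) (2 ^ b) s t ⟩
  2 ^ a * 2 ^ b * (1 + 2 * (s + t + 2 * s * t))  ≡⟨ cong (_* _) (sym (^-distribˡ-+-* 2 a b)) ⟩
  2 ^ (a + b) * (1 + 2 * (s + t + 2 * s * t))    ∎)
  where
  open ≡-Reasoning
  regroup : ∀ P Q s t → P * (1 + 2 * s) * (Q * (1 + 2 * t)) ≡ P * Q * (1 + 2 * (s + t + 2 * s * t))
  regroup = solve-∀

-- Congruences of natural numbers, phrased without subtraction

infix 4 _≡_mod_
record _≡_mod_ (X Y P : ℕ) : Set where
  constructor congruent
  field
    a b  : ℕ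
    same : X + P * a ≡ Y + P * b

≡mod-reflexive : ∀ {P X Y} → X ≡ Y → X ≡ Y mod P
≡mod-reflexive refl = congruent 0 0 refl

≡mod-subst : ∀ {P X X′ Y Y′} → X ≡ X′ → Y ≡ Y′ → X ≡ Y mod P → X′ ≡ Y′ mod P
≡mod-subst refl refl X≡Y = X≡Y

≡mod-+ : ∀ {P X₁ Y₁ X₂ Y₂} → X₁ ≡ Y₁ mod P → X₂ ≡ Y₂ mod P → X₁ + X₂ ≡ Y₁ + Y₂ mod P
≡mod-+ {P} {X₁} {Y₁} {X₂} {Y₂} (congruent a₁ b₁ e₁) (congruent a₂ b₂ e₂) =
  congruent (a₁ + a₂) (b₁ + b₂)
    (trans (regroup X₁ X₂ P a₁ a₂) (trans (cong₂ _+_ e₁ e₂) (sym (regroup Y₁ Y₂ P b₁ b₂))))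
  where
  regroup : ∀ X₁ X₂ P a₁ a₂ → (X₁ + X₂) + P * (a₁ + a₂) ≡ (X₁ + P * a₁) + (X₂ + P * a₂)
  regroup = solve-∀

≡mod-sumTo : ∀ P f g N → (∀ k → k ≤ N → f k ≡ g k mod P) → sumTo f N ≡ sumTo g N mod P
≡mod-sumTo P f g zero    f≡g = f≡g 0 z≤n
≡mod-sumTo P f g (suc N) f≡g =
  ≡mod-+ (≡mod-sumTo P f g N (λ k k≤N → f≡g k (m≤n⇒m≤1+n k≤N))) (f≡g (suc N) ≤-refl)

IsVal-transfer : ∀ {p P X Y v} → X ≡ Y mod P → p ^ suc v ∣ P → IsVal p Y v → IsVal p X v
IsVal-transfer {p} {P} {X} {Y} {v} (congruent a b X+Pa≡Y+Pb) pᵛ⁺¹∣P (pᵛ∣Y , pᵛ⁺¹∤Y) = pᵛ∣X , pᵛ⁺¹∤X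
  where
  pᵛ∣P : p ^ v ∣ P
  pᵛ∣P = ∣-trans (divides p refl) pᵛ⁺¹∣P
  Y+Pb≡Pa+X : Y + P * b ≡ P * a + X
  Y+Pb≡Pa+X = trans (sym X+Pa≡Y+Pb) (+-comm X (P * a))
  pᵛ∣X : p ^ v ∣ X
  pᵛ∣X = ∣m+n∣m⇒∣n (subst (p ^ v ∣_) Y+Pb≡Pa+X (∣m∣n⇒∣m+n pᵛ∣Y (∣m⇒∣m*n b pᵛ∣P)))
                    (∣m⇒∣m*n a pᵛ∣P)
  pᵛ⁺¹∤X : ¬ (p ^ suc v ∣ X)
  pᵛ⁺¹∤X pᵛ⁺¹∣X = pᵛ⁺¹∤Y (∣m+n∣m⇒∣n
    (subst (p ^ suc v ∣_) (trans X+Pa≡Y+Pb (+-comm Y (P * b)))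
           (∣m∣n⇒∣m+n pᵛ⁺¹∣X (∣m⇒∣m*n a pᵛ⁺¹∣P)))
    (∣m⇒∣m*n b pᵛ⁺¹∣P))

-- (y + x)^(m+1) ≡ x^(m+1) + (m+1) y x^m modulo y², over ℤ so that it also
-- applies to a difference N - k.
binomial-mod-square : ∀ (y x : ℤ) m → Σ ℤ λ t →
  (y ℤ.+ x) ℤ.^ suc m ≡ x ℤ.^ suc m ℤ.+ + suc m ℤ.* y ℤ.* x ℤ.^ m ℤ.+ y ℤ.* y ℤ.* t
binomial-mod-square y x zero    = ℤ.0ℤ , base y x
  where
  base : ∀ y x → (y ℤ.+ x) ℤ.* ℤ.1ℤ ≡ x ℤ.* ℤ.1ℤ ℤ.+ ℤ.1ℤ ℤ.* y ℤ.* ℤ.1ℤ ℤ.+ y ℤ.* y ℤ.* ℤ.0ℤ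
  base = solve-∀ℤ
binomial-mod-square y x (suc m) with binomial-mod-square y x m
... | t , eq = + suc m ℤ.* x ℤ.^ m ℤ.+ (y ℤ.+ x) ℤ.* t , (begin
  (y ℤ.+ x) ℤ.* (y ℤ.+ x) ℤ.^ suc m
    ≡⟨ cong ((y ℤ.+ x) ℤ.*_) eq ⟩
  (y ℤ.+ x) ℤ.* (x ℤ.* xᵐ ℤ.+ c ℤ.* y ℤ.* xᵐ ℤ.+ y ℤ.* y ℤ.* t)
    ≡⟨ step y x xᵐ c t ⟩
  x ℤ.* (x ℤ.* xᵐ) ℤ.+ + suc (suc m) ℤ.* y ℤ.* (x ℤ.* xᵐ)
    ℤ.+ y ℤ.* y ℤ.* (c ℤ.* xᵐ ℤ.+ (y ℤ.+ x) ℤ.* t) ∎)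
  where
  open ≡-Reasoning
  xᵐ : ℤ
  xᵐ = x ℤ.^ m
  c : ℤ
  c  = + suc m
  step : ∀ y x xᵐ c t → (y ℤ.+ x) ℤ.* (x ℤ.* xᵐ ℤ.+ c ℤ.* y ℤ.* xᵐ ℤ.+ y ℤ.* y ℤ.* t)
       ≡ x ℤ.* (x ℤ.* xᵐ) ℤ.+ (ℤ.1ℤ ℤ.+ c) ℤ.* y ℤ.* (x ℤ.* xᵐ)
         ℤ.+ y ℤ.* y ℤ.* (c ℤ.* xᵐ ℤ.+ (y ℤ.+ x) ℤ.* t)
  step = solve-∀ℤ

pos-^ : ∀ a m → (+ a) ℤ.^ m ≡ + (a ^ m)
pos-^ a zero    = refl
pos-^ a (suc m) = trans (cong (λ z → + a ℤ.* z) (pos-^ a m)) (sym (ℤₚ.pos-* a (a ^ m)))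

pos-*³ : ∀ a b c → + (a * b * c) ≡ + a ℤ.* + b ℤ.* + c
pos-*³ a b c = trans (ℤₚ.pos-* (a * b) c) (cong (ℤ._* + c) (ℤₚ.pos-* a b))

pos-injective-lin : ∀ {X Y P a b} →
  + X ℤ.+ + P ℤ.* + a ≡ + Y ℤ.+ + P ℤ.* + b → X + P * a ≡ Y + P * b
pos-injective-lin {X} {Y} {P} {a} {b} eq =
  ℤₚ.+-injective (trans (pos-lin X a) (trans eq (sym (pos-lin Y b))))
  where
  pos-lin : ∀ X a → + (X + P * a) ≡ + X ℤ.+ + P ℤ.* + a
  pos-lin X a = trans (ℤₚ.pos-+ X (P * a)) (cong (λ z → + X ℤ.+ z) (ℤₚ.pos-* P a))

≡mod-fromℤ : ∀ {P X Y} t → + X ≡ + Y ℤ.+ + P ℤ.* t → X ≡ Y mod P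
≡mod-fromℤ {P} {X} {Y} (+ b) eq =
  congruent 0 b (pos-injective-lin {X} {Y} {P} (trans (drop-zero (+ X) (+ P)) eq))
  where
  drop-zero : ∀ X P → X ℤ.+ P ℤ.* ℤ.0ℤ ≡ X
  drop-zero = solve-∀ℤ
≡mod-fromℤ {P} {X} {Y} -[1+ a ] eq =
  congruent (suc a) 0 (pos-injective-lin {X} {Y} {P}
    (trans (cong (ℤ._+ + P ℤ.* + suc a) eq) (move (+ Y) (+ P) (+ suc a))))
  where
  move : ∀ Y P s → Y ℤ.+ P ℤ.* ℤ.- s ℤ.+ P ℤ.* s ≡ Y ℤ.+ P ℤ.* ℤ.0ℤ
  move = solve-∀ℤ

pow-shift : ∀ M k m → (M + k) ^ suc m ≡ k ^ suc m + suc m * M * k ^ m mod M * M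
pow-shift M k m with binomial-mod-square (+ M) (+ k) m
... | t , eq = ≡mod-fromℤ t (begin
  + ((M + k) ^ suc m)
    ≡⟨ sym (pos-^ (M + k) (suc m)) ⟩
  (+ (M + k)) ℤ.^ suc m
    ≡⟨ cong (ℤ._^ suc m) (ℤₚ.pos-+ M k) ⟩
  (+ M ℤ.+ + k) ℤ.^ suc m
    ≡⟨ eq ⟩
  (+ k) ℤ.^ suc m ℤ.+ + suc m ℤ.* + M ℤ.* (+ k) ℤ.^ m ℤ.+ + M ℤ.* + M ℤ.* t
    ≡⟨ cong₂ (λ u w → u ℤ.+ w ℤ.+ + M ℤ.* + M ℤ.* t) (pos-^ k (suc m)) linear-term ⟩
  + (k ^ suc m) ℤ.+ + (suc m * M * k ^ m) ℤ.+ + M ℤ.* + M ℤ.* t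
    ≡⟨ cong₂ (λ u w → u ℤ.+ w ℤ.* t) (sym (ℤₚ.pos-+ (k ^ suc m) _)) (sym (ℤₚ.pos-* M M)) ⟩
  + (k ^ suc m + suc m * M * k ^ m) ℤ.+ + (M * M) ℤ.* t ∎)
  where
  open ≡-Reasoning
  linear-term : + suc m ℤ.* + M ℤ.* (+ k) ℤ.^ m ≡ + (suc m * M * k ^ m)
  linear-term =
    trans (cong (λ z → + suc m ℤ.* + M ℤ.* z) (pos-^ k m)) (sym (pos-*³ (suc m) M (k ^ m)))

neg-^-even : ∀ x c → (ℤ.- x) ℤ.^ (c * 2) ≡ x ℤ.^ (c * 2)
neg-^-even x zero    = refl
neg-^-even x (suc c) =
  trans (square-neg x ((ℤ.- x) ℤ.^ (c * 2))) (cong (λ z → x ℤ.* (x ℤ.* z)) (neg-^-even x c))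
  where
  square-neg : ∀ x z → (ℤ.- x) ℤ.* ((ℤ.- x) ℤ.* z) ≡ x ℤ.* (x ℤ.* z)
  square-neg = solve-∀ℤ

neg-^-odd : ∀ x c → (ℤ.- x) ℤ.^ suc (c * 2) ≡ ℤ.- (x ℤ.^ suc (c * 2))
neg-^-odd x c =
  trans (cong ((ℤ.- x) ℤ.*_) (neg-^-even x c)) (sym (ℤₚ.neg-distribˡ-* x (x ℤ.^ (c * 2))))

-- For odd n and N = k + b:  k^n + b^n ≡ n N k^(n-1) mod N², by expanding
-- b^n = (N - k)^n with the binomial congruence.
pow-pair : ∀ c k b → let n = suc (c * 2) in
  k ^ n + b ^ n ≡ n * (k + b) * k ^ (c * 2) mod (k + b) * (k + b)
pow-pair c k b with binomial-mod-square (+ (k + b)) (ℤ.- (+ k)) (c * 2)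
... | t , eq = ≡mod-fromℤ t (begin
  + (k ^ n + b ^ n)
    ≡⟨ ℤₚ.pos-+ (k ^ n) (b ^ n) ⟩
  + (k ^ n) ℤ.+ + (b ^ n)
    ≡⟨ cong₂ ℤ._+_ (sym (pos-^ k n)) (trans (sym (pos-^ b n)) (cong (ℤ._^ n) (sym N-k≡b))) ⟩
  K ℤ.^ n ℤ.+ (N ℤ.+ ℤ.- K) ℤ.^ n
    ≡⟨ cong (λ z → K ℤ.^ n ℤ.+ z) eq ⟩
  K ℤ.^ n ℤ.+ ((ℤ.- K) ℤ.^ n ℤ.+ + n ℤ.* N ℤ.* (ℤ.- K) ℤ.^ (c * 2) ℤ.+ N ℤ.* N ℤ.* t)
    ≡⟨ cong₂ (λ u w → K ℤ.^ n ℤ.+ (u ℤ.+ + n ℤ.* N ℤ.* w ℤ.+ N ℤ.* N ℤ.* t))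
             (neg-^-odd K c) (neg-^-even K c) ⟩
  K ℤ.^ n ℤ.+ (ℤ.- (K ℤ.^ n) ℤ.+ + n ℤ.* N ℤ.* K ℤ.^ (c * 2) ℤ.+ N ℤ.* N ℤ.* t)
    ≡⟨ cancel (K ℤ.^ n) (+ n ℤ.* N ℤ.* K ℤ.^ (c * 2)) (N ℤ.* N ℤ.* t) ⟩
  + n ℤ.* N ℤ.* K ℤ.^ (c * 2) ℤ.+ N ℤ.* N ℤ.* t
    ≡⟨ cong₂ (λ u w → u ℤ.+ w ℤ.* t) linear-term (sym (ℤₚ.pos-* (k + b) (k + b))) ⟩
  + (n * (k + b) * k ^ (c * 2)) ℤ.+ + ((k + b) * (k + b)) ℤ.* t ∎)
  where
  open ≡-Reasoning
  n : ℕ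
  n = suc (c * 2)
  K : ℤ
  K = + k
  N : ℤ
  N = + (k + b)
  N-k≡b : N ℤ.+ ℤ.- K ≡ + b
  N-k≡b = trans (cong (ℤ._+ ℤ.- K) (ℤₚ.pos-+ k b)) (add-sub K (+ b))
    where
    add-sub : ∀ u v → u ℤ.+ v ℤ.+ ℤ.- u ≡ v
    add-sub = solve-∀ℤ
  cancel : ∀ A u w → A ℤ.+ (ℤ.- A ℤ.+ u ℤ.+ w) ≡ u ℤ.+ w
  cancel = solve-∀ℤ
  linear-term : + n ℤ.* N ℤ.* K ℤ.^ (c * 2) ≡ + (n * (k + b) * k ^ (c * 2))
  linear-term =
    trans (cong (λ z → + n ℤ.* N ℤ.* z) (pos-^ k (c * 2))) (sym (pos-*³ n (k + b) (k ^ (c * 2))))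

-- Two congruences for power sums modulo squares

-- Doubling: S n (M + L) ≡ S n M + S n L + n M S (n-1) L  mod M², obtained by
-- expanding each (M + k)^n for 1 ≤ k ≤ L.
S-shift : ∀ m M L → S (suc m) (M + L) ≡ S (suc m) M + S (suc m) L + suc m * M * S m L mod M * M
S-shift m M zero    =
  ≡mod-reflexive (trans (cong (S (suc m)) (+-identityʳ M)) (pad (S (suc m) M) (suc m) M))
  where
  pad : ∀ A c M → A ≡ A + 0 + c * M * 0
  pad = solve-∀
S-shift m M (suc L) =
  ≡mod-subst (trans (cong (λ z → S n (M + L) + z ^ n) (+-suc M L)) (cong (S n) (sym (+-suc M L))))
             (regroup (S n M) (S n L) (S m L) n M (suc L ^ n) (suc L ^ m))
             (≡mod-+ (S-shift m M L) (pow-shift M (suc L) m))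
  where
  n : ℕ
  n = suc m
  regroup : ∀ A B C c M D E → A + B + c * M * C + (D + c * M * E) ≡ A + (B + D) + c * M * (C + E)
  regroup = solve-∀

-- Pairing: for odd n ≥ 3,  2 S n N ≡ n N S (n-1) N  mod N², by summing
-- k^n + (N - k)^n ≡ n N k^(n-1) over 0 ≤ k ≤ N.
S-pair : ∀ c N → let n = suc (suc c * 2) in 2 * S n N ≡ n * N * S (suc c * 2) N mod N * N
S-pair c N = ≡mod-subst paired-sum factored-sum (≡mod-sumTo (N * N) _ _ N pointwise)
  where
  n : ℕ
  n = suc (suc c * 2)
  m : ℕ
  m = suc c * 2
  pointwise : ∀ k → k ≤ N → k ^ n + (N ∸ k) ^ n ≡ n * N * k ^ m mod N * N
  pointwise k k≤N =
    subst (λ z → k ^ n + (N ∸ k) ^ n ≡ n * z * k ^ m mod z * z) (m+[n∸m]≡n k≤N)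
          (pow-pair (suc c) k (N ∸ k))
  paired-sum : sumTo (λ k → k ^ n + (N ∸ k) ^ n) N ≡ 2 * S n N
  paired-sum = begin
    sumTo (λ k → k ^ n + (N ∸ k) ^ n) N
      ≡⟨ sumTo-+ (_^ n) (λ k → (N ∸ k) ^ n) N ⟩
    sumTo (_^ n) N + sumTo (λ k → (N ∸ k) ^ n) N
      ≡⟨ cong (λ z → sumTo (_^ n) N + z) (sumTo-reverse (_^ n) N) ⟩
    sumTo (_^ n) N + sumTo (_^ n) N
      ≡⟨ cong₂ _+_ (sumTo-pow m N) (sumTo-pow m N) ⟩
    S n N + S n N
      ≡⟨ double (S n N) ⟩
    2 * S n N ∎
    where
    open ≡-Reasoning
    double : ∀ x → x + x ≡ 2 * x
    double = solve-∀
  factored-sum : sumTo (λ k → n * N * k ^ m) N ≡ n * N * S m N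
  factored-sum = trans (sumTo-*ˡ (n * N) (_^ m) N) (cong (n * N *_) (sumTo-pow (suc (c * 2)) N))

-- The three cases, for N = 2^(e+1) q with q = 1 + 2r odd

-- Even exponent: v(S n N) = e, by induction on e using doubling.
S-even-val : ∀ m → 2 ∣ suc m → ∀ r e → IsVal 2 (S (suc m) (2 ^ suc e * (1 + 2 * r))) e
S-even-val m n-even r zero with S-parity m (1 + 2 * r)
... | t , S≡ = Val₂⇒IsVal {v = 0} (odd-part (r + t) (trans S≡ (odd-sum r t)))
  where
  odd-sum : ∀ r t → 1 + 2 * r + 2 * t ≡ 1 * (1 + 2 * (r + t))
  odd-sum = solve-∀
S-even-val m n-even@(divides c n≡c*2) r (suc e) =
  IsVal-transfer {p = 2} {v = suc e} doubled 2ᵉ⁺²∣N² v[2S+cross]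
  where
  n : ℕ
  n = suc m
  q : ℕ
  q = 1 + 2 * r
  N : ℕ
  N = 2 ^ suc e * q
  B : ℕ
  B = S m N
  doubled : S n (2 ^ suc (suc e) * q) ≡ S n N + S n N + n * N * B mod N * N
  doubled = ≡mod-subst (cong (S n) (twice (2 ^ suc e) q)) refl (S-shift m N N)
    where
    twice : ∀ P q → P * q + P * q ≡ 2 * P * q
    twice = solve-∀
  2ᵉ⁺²∣N² : 2 ^ suc (suc e) ∣ N * N
  2ᵉ⁺²∣N² = divides (2 ^ e * q * q) (square (2 ^ e) q)
    where
    square : ∀ P q → 2 * P * q * (2 * P * q) ≡ P * q * q * (2 * (2 * P))
    square = solve-∀
  -- n is even, so the cross term n N B is divisible by 2^(e+2).
  even-cross-term : S n N + S n N + n * N * B ≡ 2 * S n N mod 2 ^ suc (suc e)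
  even-cross-term = congruent 0 (c * q * B)
    (trans (cong (λ k → S n N + S n N + k * N * B + 2 ^ suc (suc e) * 0) n≡c*2)
           (factor (S n N) c (2 ^ e) q B))
    where
    factor : ∀ A c P q B →
      A + A + c * 2 * (2 * P * q) * B + 2 * (2 * P) * 0 ≡ 2 * A + 2 * (2 * P) * (c * q * B)
    factor = solve-∀
  v[2S] : IsVal 2 (2 * S n N) (suc e)
  v[2S] = IsVal-*ˡ {p = 2} {v = e} (S-even-val m n-even r e)
  v[2S+cross] : IsVal 2 (S n N + S n N + n * N * B) (suc e)
  v[2S+cross] = IsVal-transfer {p = 2} {v = suc e} even-cross-term ∣-refl v[2S]

gauss : ∀ N → 2 * S 1 N ≡ N * suc N
gauss zero    = refl
gauss (suc N) = trans (distrib (S 1 N) N) (trans (cong (_+ 2 * suc N) (gauss N)) (step N))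
  where
  distrib : ∀ A N → 2 * (A + suc N * 1) ≡ 2 * A + 2 * suc N
  distrib = solve-∀
  step : ∀ N → N * suc N + 2 * suc N ≡ suc N * suc (suc N)
  step = solve-∀

-- n = 1: v(S 1 N) = v(N (N + 1)) - 1 = e.
S-one-val : ∀ r e → IsVal 2 (S 1 (2 ^ suc e * (1 + 2 * r))) e
S-one-val r e = IsVal-*ˡ⁻¹ {p = 2} {v = e} v[2S]
  where
  q : ℕ
  q = 1 + 2 * r
  N : ℕ
  N = 2 ^ suc e * q
  N-val : Val₂ N (suc e)
  N-val = odd-part r refl
  N+1-odd : Val₂ (suc N) 0
  N+1-odd = odd-part (2 ^ e * q) (succ (2 ^ e) q)
    where
    succ : ∀ P q → suc (2 * P * q) ≡ 1 * (1 + 2 * (P * q))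
    succ = solve-∀
  v[N[N+1]] : Val₂ (N * suc N) (suc e)
  v[N[N+1]] = subst (Val₂ (N * suc N)) (+-identityʳ (suc e)) (Val₂-* N-val N+1-odd)
  v[2S] : IsVal 2 (2 * S 1 N) (suc e)
  v[2S] = subst (λ x → IsVal 2 x (suc e)) (sym (gauss N)) (Val₂⇒IsVal v[N[N+1]])

-- Odd exponent n ≥ 3: by pairing, v(2 S n N) = v(n N S (n-1) N) = 0 + (e + 1) + e.
S-odd-val : ∀ c r e → IsVal 2 (S (suc (suc c * 2)) (2 ^ suc e * (1 + 2 * r))) (2 * e)
S-odd-val c r e =
  subst (IsVal 2 (S n N)) (sym (double e)) (IsVal-*ˡ⁻¹ {p = 2} {v = e + e} v[2S])
  where
  n : ℕ
  n = suc (suc c * 2)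
  m : ℕ
  m = suc c * 2
  q : ℕ
  q = 1 + 2 * r
  N : ℕ
  N = 2 ^ suc e * q
  double : ∀ e → 2 * e ≡ e + e
  double = solve-∀
  N-val : Val₂ N (suc e)
  N-val = odd-part r refl
  n-odd : Val₂ n 0
  n-odd = odd-part (suc c) (odd-form c)
    where
    odd-form : ∀ c → suc (suc c * 2) ≡ 1 * (1 + 2 * suc c)
    odd-form = solve-∀
  S′-val : Val₂ (S m N) e
  S′-val = IsVal⇒Val₂ (S-even-val (suc (c * 2)) (divides (suc c) refl) r e)
  v[nNB] : IsVal 2 (n * N * S m N) (suc (e + e))
  v[nNB] = Val₂⇒IsVal (Val₂-* (Val₂-* n-odd N-val) S′-val)
  2²ᵉ⁺²∣N² : 2 ^ suc (suc (e + e)) ∣ N * N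
  2²ᵉ⁺²∣N² = divides (q * q)
    (trans (square (2 ^ e) q) (cong (λ z → q * q * (2 * (2 * z))) (sym (^-distribˡ-+-* 2 e e))))
    where
    square : ∀ P q → 2 * P * q * (2 * P * q) ≡ q * q * (2 * (2 * (P * P)))
    square = solve-∀
  v[2S] : IsVal 2 (2 * S n N) (suc (e + e))
  v[2S] = IsVal-transfer {p = 2} {v = suc (e + e)} (S-pair c N) 2²ᵉ⁺²∣N² v[nNB]

odd≥3-form : ∀ n → 3 ≤ n → ¬ (2 ∣ n) → Σ ℕ λ c → n ≡ suc (suc c * 2)
odd≥3-form (suc (suc (suc k))) (s≤s (s≤s (s≤s _))) n-odd with parity k
... | inj₁ (a , k≡2a)   = a , cong (λ x → 3 + x) (trans k≡2a (*-comm 2 a))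
... | inj₂ (a , k≡1+2a) =
  ⊥-elim (n-odd (divides (2 + a) (trans (cong (λ x → 3 + x) k≡1+2a) (even-form a))))
  where
  even-form : ∀ a → 3 + (1 + 2 * a) ≡ (2 + a) * 2
  even-form = solve-∀

mainTheorem2 : (n d q : ℕ) → 1 ≤ n → 1 ≤ d → 1 ≤ q → ¬ (2 ∣ q) →
    ((n ≡ 1 ⊎ 2 ∣ n → IsVal 2 (S n (2 ^ d * q)) (d ∸ 1)) ×
     (3 ≤ n → ¬ (2 ∣ n) → IsVal 2 (S n (2 ^ d * q)) (2 * (d ∸ 1))))
mainTheorem2 (suc m) (suc e) q _ _ _ q-odd with parity q
... | inj₁ (a , q≡2a) = ⊥-elim (q-odd (divides a (trans q≡2a (*-comm 2 a))))
... | inj₂ (r , refl) = even-or-one , odd-at-least-three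
  where
  N : ℕ
  N = 2 ^ suc e * (1 + 2 * r)
  even-or-one : suc m ≡ 1 ⊎ 2 ∣ suc m → IsVal 2 (S (suc m) N) e
  even-or-one (inj₁ refl)   = S-one-val r e
  even-or-one (inj₂ n-even) = S-even-val m n-even r e
  odd-at-least-three : 3 ≤ suc m → ¬ (2 ∣ suc m) → IsVal 2 (S (suc m) N) (2 * e)
  odd-at-least-three 3≤n n-odd with odd≥3-form (suc m) 3≤n n-odd
  ... | c , n≡ = subst (λ n → IsVal 2 (S n N) (2 * e)) (sym n≡) (S-odd-val c r e)
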